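{- Let $c$, $\prec$, $T'$ be as in the context. Let $\beta\colon\mathbb{N}\to\mathbb{N}$ satisfy $\forall n\ \forall s\in\mathbb{B}^n\,(\exists k\,T'(s,k)\to T'(s,\beta n))$, and let $\alpha\colon\mathbb{N}\to\mathbb{B}$ satisfy $\forall n\ \exists k\in[n,\beta n]\ \forall i<n\,(\alpha(i)=0\leftrightarrow i\prec k)$. Define $a(0)=0$ and, for $n>0$, $a(n)$ = the least $k\in[n,\beta(\beta n+1)]$ with $\alpha(k)=0$. Then $a$ is well defined (such a $k$ always exists) and $\alpha(a(n))=0$ for all $n$; in particular $\alpha$ has infinitely many zeros, i.e. it is the characteristic function (zeros marking membership) of an infinite set.
   Context: $\mathbb{B}=\{0,1\}$; $c\colon\mathbb{N}^2\to\mathbb{B}$ with $c(i,j)=c(j,i)$. The Erdős–Rado order $\prec$: $0\prec1$, and, given $\prec$ already defined on $\{0,\dots,j\}$, for $j<i$ set $j\prec i$ iff $c(k,i)=c(k,j)$ for all $k\prec j$. For a finite binary sequence $s$ of length $|s|$ with entries $s_0,\dots,s_{|s|-1}$ and $k\in\mathbb{N}$: $T'(s,k):\equiv\exists k'\in[|s|,k]\ \forall i<|s|\,(s_i=0\leftrightarrow i\prec k')$. -}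

module Defs where

open import Data.Bool using (Bool; true; false; _∧_; _∨_; not; T)
open import Data.Nat using (ℕ; zero; suc; _≤_; _<_; _<ᵇ_)
open import Data.Nat.Properties using (_≟_)
open import Data.Fin using (Fin; toℕ)
open import Data.Product using (∃; _×_; _,_)
open import Function.Bundles using (_⇔_)
open import Relation.Binary.PropositionalEquality using (_≡_)
open import Relation.Nullary.Decidable using (⌊_⌋)

-- 𝔹 = {0,1} is rendered as Bool with 0 = false and 1 = true.
Colouring : Set
Colouring = ℕ → ℕ → Bool

Symmetric : Colouring → Set
Symmetric c = ∀ i j → c i j ≡ c j i

_==_ : Bool → Bool → Bool
true  == b = b
false == b = not b

allBelow : ℕ → (ℕ → Bool) → Bool
allBelow zero    p = true
allBelow (suc j) p = allBelow j p ∧ p j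

-- Fuel-based computation of the Erdős–Rado order:
-- precF f j i decides  j ≺ i  whenever  f ≥ i.
--   j ≺ i  iff  j < i  and  for all k ≺ j :  c k i = c k j.
-- (every k ≺ j satisfies k < j, so "∀ k ≺ j" is a bounded quantifier over k < j)
precF : Colouring → ℕ → ℕ → ℕ → Bool
precF c zero    j i = false
precF c (suc f) j i =
  (j <ᵇ i) ∧ allBelow j (λ k → not (precF c f k j) ∨ (c k i == c k j))

_≺[_]_ : ℕ → Colouring → ℕ → Set
j ≺[ c ] i = T (precF c i j i)

T′ : Colouring → {n : ℕ} → (Fin n → Bool) → ℕ → Set
T′ c {n} s k = ∃ λ k′ → n ≤ k′ × k′ ≤ k ×
  (∀ (i : Fin n) → (s i ≡ false) ⇔ (toℕ i ≺[ c ] k′))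

IsLeastZeroIn : (ℕ → Bool) → ℕ → ℕ → ℕ → Set
IsLeastZeroIn α lo hi k =
  lo ≤ k × k ≤ hi × α k ≡ false × (∀ m → lo ≤ m → m < k → α m ≡ true)

-- Let Z be the set of zeros of α below n (0 ∈ Z, as 0 ≺ k for all k > 0) and p its maximum.
-- For N ≥ n the key k coding α below N has Z as its set of predecessors below n, so the
-- lowest ancestor of k of height ≥ n has predecessor set exactly Z.  Two such nodes that
-- give p the same colour are ≺-related, because Z is a ≺-chain with top p.  If α had no
-- zero in [n, β (β n + 1)], the keys for N = n, β n + 1 and b + 1 (b the key for β n + 1)
-- would give three such nodes, no two of them ≺-related (that would make the lower one a
-- zero of α in the window); but two of the three colours c p (·) agree.
module Submission where

open import Defs
open import Data.Bool using (Bool; true; false; _∧_; _∨_; not; T)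
open import Data.Bool.Properties using (T-∧; T?; ¬-not) renaming (_≟_ to _≟ᵇ_)
open import Data.Empty using (⊥)
open import Data.Fin using (Fin)
open import Data.Nat using (ℕ; zero; suc; _+_; _≤_; _<_; _<ᵇ_; z≤n; s≤s; z<s)
open import Data.Nat.Induction using (<-rec)
open import Data.Nat.Properties
open import Data.Product using (Σ; ∃; _×_; _,_; proj₁; proj₂)
open import Data.Sum using (_⊎_; inj₁; inj₂)
open import Function using (_∘_)
open import Function.Bundles using (_⇔_; mk⇔; Equivalence)
open import Relation.Binary.Construct.Closure.Reflexive using (ReflClosure; refl; [_])
open import Relation.Binary.PropositionalEquality using (_≡_; refl; sym; trans; cong; cong₂; subst)
open import Relation.Nullary using (¬_; Dec; yes; no; map′; contradiction)
open import Relation.Nullary.Decidable using (_×-dec_)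
open import Relation.Unary using (Decidable)

open Equivalence using (to; from)

T-== : ∀ {x y} → T (x == y) ⇔ x ≡ y
T-== {true}  {true}  = mk⇔ (λ _ → refl) _
T-== {true}  {false} = mk⇔ (λ ()) (λ ())
T-== {false} {true}  = mk⇔ (λ ()) (λ ())
T-== {false} {false} = mk⇔ (λ _ → refl) _

T-not-∨ : ∀ {x y} → T (not x ∨ y) ⇔ (T x → T y)
T-not-∨ {true}  = mk⇔ (λ t _ → t) (λ f → f _)
T-not-∨ {false} = mk⇔ (λ _ ()) _

T-allBelow : ∀ j {p} → T (allBelow j p) ⇔ (∀ {k} → k < j → T (p k))
T-allBelow zero    = mk⇔ (λ _ ()) _
T-allBelow (suc j) = mk⇔ below above
  where
  below : ∀ {p} → T (allBelow (suc j) p) → ∀ {k} → k < suc j → T (p k)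
  below t k<1+j with to T-∧ t | m<1+n⇒m<n∨m≡n k<1+j
  ... | (t′ , _)  | inj₁ k<j = to (T-allBelow j) t′ k<j
  ... | (_  , pj) | inj₂ refl = pj
  above : ∀ {p} → (∀ {k} → k < suc j → T (p k)) → T (allBelow (suc j) p)
  above f = from T-∧ (from (T-allBelow j) (λ k<j → f (m<n⇒m<1+n k<j)) , f ≤-refl)

allBelow-cong : ∀ j {p q} → (∀ {k} → k < j → p k ≡ q k) → allBelow j p ≡ allBelow j q
allBelow-cong zero    _   = refl
allBelow-cong (suc j) p≗q = cong₂ _∧_ (allBelow-cong j (λ k<j → p≗q (m<n⇒m<1+n k<j))) (p≗q ≤-refl)

minimise : ∀ {P : ℕ → Set} → Decidable P → ∀ {k} → P k →
           ∃ λ m → m ≤ k × P m × (∀ {i} → i < m → ¬ P i)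
minimise {P} P? {k} = <-rec (λ k → P k → ∃ λ m → m ≤ k × P m × (∀ {i} → i < m → ¬ P i)) step k
  where
  step : ∀ k → (∀ {i} → i < k → P i → ∃ λ m → m ≤ i × P m × (∀ {j} → j < m → ¬ P j)) →
         P k → ∃ λ m → m ≤ k × P m × (∀ {i} → i < m → ¬ P i)
  step k rec Pk with anyUpTo? P? k
  ... | yes (i , i<k , Pi) = let (m , m≤i , Pm , least) = rec i<k Pi in m , ≤-trans m≤i (<⇒≤ i<k) , Pm , least
  ... | no none            = k , ≤-refl , Pk , λ i<k Pi → none (_ , i<k , Pi)

maximiseBelow : ∀ {P : ℕ → Set} → Decidable P → ∀ v {k} → k < v → P k →
                ∃ λ p → p < v × P p × (∀ {i} → i < v → P i → i ≤ p)
maximiseBelow {P} P? (suc v) {k} k<1+v Pk with P? v | m<1+n⇒m<n∨m≡n k<1+v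
... | yes Pv | _         = v , ≤-refl , Pv , λ i<1+v _ → ≤-pred i<1+v
... | no ¬Pv | inj₂ refl = contradiction Pk ¬Pv
... | no ¬Pv | inj₁ k<v  = let (p , p<v , Pp , top) = maximiseBelow P? v k<v Pk in
  p , m<n⇒m<1+n p<v , Pp , λ i<1+v Pi → below-top (m<1+n⇒m<n∨m≡n i<1+v) Pi top
  where
  below-top : ∀ {i p} → i < v ⊎ i ≡ v → P i → (∀ {i} → i < v → P i → i ≤ p) → i ≤ p
  below-top (inj₁ i<v) Pi top = top i<v Pi
  below-top (inj₂ refl) Pi _  = contradiction Pi ¬Pv

pigeonhole : ∀ (x y z : Bool) → x ≡ y ⊎ x ≡ z ⊎ y ≡ z
pigeonhole true  true  _     = inj₁ refl
pigeonhole false false _     = inj₁ refl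
pigeonhole true  false true  = inj₂ (inj₁ refl)
pigeonhole false true  false = inj₂ (inj₁ refl)
pigeonhole true  false false = inj₂ (inj₂ refl)
pigeonhole false true  true  = inj₂ (inj₂ refl)

module ErdősRado (c : Colouring) where

  precF-fuel : ∀ f g {j i} → i ≤ f → i ≤ g → precF c f j i ≡ precF c g j i
  precF-fuel zero    zero    _   _   = refl
  precF-fuel zero    (suc g) z≤n _   = refl
  precF-fuel (suc f) zero    _   z≤n = refl
  precF-fuel (suc f) (suc g) {j} {i} i≤1+f i≤1+g with j <ᵇ i in j<ᵇi
  ... | false = refl
  ... | true  = allBelow-cong j λ _ →
          cong (λ b → not b ∨ _) (precF-fuel f g (≤-pred (≤-trans j<i i≤1+f)) (≤-pred (≤-trans j<i i≤1+g)))
    where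
    j<i : j < i
    j<i = <ᵇ⇒< j i (subst T (sym j<ᵇi) _)

  -- A record, so that j and i can be inferred from a proof of j ≺ i.
  record _≺_ (j i : ℕ) : Set where
    constructor mk≺
    field holds : j ≺[ c ] i
  open _≺_

  _≺?_ : ∀ j i → Dec (j ≺ i)
  j ≺? i = map′ mk≺ holds (T? _)

  ≺⇒< : ∀ {j i} → j ≺ i → j < i
  ≺⇒< {j} {suc i} (mk≺ t) = <ᵇ⇒< j (suc i) (proj₁ (to T-∧ t))

  ≺⇒colour≡ : ∀ {j i k} → j ≺ i → k ≺ j → c k i ≡ c k j
  ≺⇒colour≡ {j} {suc i} j≺i@(mk≺ t) k≺j@(mk≺ u) =
    to T-== (to T-not-∨ (to (T-allBelow j) (proj₂ (to T-∧ t)) (≺⇒< k≺j))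
                        (subst T (precF-fuel j i ≤-refl (≤-pred (≺⇒< j≺i))) u))

  <∧colour≡⇒≺ : ∀ {j i} → j < i → (∀ {k} → k ≺ j → c k i ≡ c k j) → j ≺ i
  <∧colour≡⇒≺ {j} {suc i} j<1+i agree = mk≺ (from T-∧ (<⇒<ᵇ j<1+i , from (T-allBelow j) λ _ →
    from T-not-∨ λ u → from T-== (agree (mk≺ (subst T (precF-fuel i j (≤-pred j<1+i) ≤-refl) u)))))

  ≺-trans : ∀ {r l a} → r ≺ l → l ≺ a → r ≺ a
  ≺-trans {r} = <-rec (λ r → ∀ {l a} → r ≺ l → l ≺ a → r ≺ a) step r
    where
    step : ∀ r → (∀ {s} → s < r → ∀ {l a} → s ≺ l → l ≺ a → s ≺ a) →
           ∀ {l a} → r ≺ l → l ≺ a → r ≺ a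
    step r rec r≺l l≺a = <∧colour≡⇒≺ (<-trans (≺⇒< r≺l) (≺⇒< l≺a)) λ s≺r →
      trans (≺⇒colour≡ l≺a (rec (≺⇒< s≺r) s≺r r≺l)) (≺⇒colour≡ r≺l s≺r)

  ≺-chain : ∀ {l p a} → l < p → l ≺ a → p ≺ a → l ≺ p
  ≺-chain {l} = <-rec (λ l → ∀ {p a} → l < p → l ≺ a → p ≺ a → l ≺ p) step l
    where
    step : ∀ l → (∀ {r} → r < l → ∀ {p a} → r < p → r ≺ a → p ≺ a → r ≺ p) →
           ∀ {p a} → l < p → l ≺ a → p ≺ a → l ≺ p
    step l rec l<p l≺a p≺a = <∧colour≡⇒≺ l<p λ r≺l →
      let r≺p = rec (≺⇒< r≺l) (<-trans (≺⇒< r≺l) l<p) (≺-trans r≺l l≺a) p≺a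
      in trans (sym (≺⇒colour≡ p≺a r≺p)) (≺⇒colour≡ l≺a r≺l)

  0≺ : ∀ {i} → 0 < i → 0 ≺ i
  0≺ 0<i = <∧colour≡⇒≺ 0<i λ k≺0 → contradiction (≺⇒< k≺0) n≮0

  -- The predecessors of u form a ≺-chain with top p, and for l ≺ p the colour c l u equals c l p.
  ≺-by-top-colour : ∀ {u v p} → u < v → (∀ {l} → l ≺ u → l ≺ v) → p ≺ u → (∀ {l} → l ≺ u → l ≤ p) →
                    c p u ≡ c p v → u ≺ v
  ≺-by-top-colour {u} {v} {p} u<v pred⊆ p≺u below-p cpu≡cpv = <∧colour≡⇒≺ u<v λ l≺u →
    agree l≺u (m≤n⇒m<n∨m≡n (below-p l≺u))
    where
    agree : ∀ {l} → l ≺ u → l < p ⊎ l ≡ p → c l v ≡ c l u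
    agree l≺u (inj₁ l<p) = let l≺p = ≺-chain l<p l≺u p≺u in
      trans (≺⇒colour≡ (pred⊆ p≺u) l≺p) (sym (≺⇒colour≡ p≺u l≺p))
    agree _   (inj₂ refl) = sym cpu≡cpv

  _≼_ : ℕ → ℕ → Set
  _≼_ = ReflClosure _≺_

  ≺-≼-trans : ∀ {x y z} → x ≺ y → y ≼ z → x ≺ z
  ≺-≼-trans x≺y [ y≺z ] = ≺-trans x≺y y≺z
  ≺-≼-trans x≺y refl    = x≺y

  ≼⇒≤ : ∀ {x y} → x ≼ y → x ≤ y
  ≼⇒≤ [ x≺y ] = <⇒≤ (≺⇒< x≺y)
  ≼⇒≤ refl    = ≤-refl

  ≼∧<⇒≺ : ∀ {x y} → x ≼ y → x < y → x ≺ y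
  ≼∧<⇒≺ [ x≺y ] _   = x≺y
  ≼∧<⇒≺ refl    x<x = contradiction x<x (<-irrefl refl)

  ≼-≺-trans : ∀ {x y z} → x ≼ y → y ≺ z → x ≺ z
  ≼-≺-trans [ x≺y ] y≺z = ≺-trans x≺y y≺z
  ≼-≺-trans refl    y≺z = y≺z

  -- node is the lowest ≼-ancestor of u of height at least n.
  record Cut (n u : ℕ) : Set where
    field
      node          : ℕ
      n≤node        : n ≤ node
      node≼u        : node ≼ u
      pred<n        : ∀ {l} → l ≺ node → l < n
      pred-restrict : ∀ {l} → l < n → l ≺ u → l ≺ node

    node≤u : node ≤ u
    node≤u = ≼⇒≤ node≼u

    pred⊆ : ∀ {l} → l ≺ node → l ≺ u
    pred⊆ l≺node = ≺-≼-trans l≺node node≼u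

  cut : ∀ {n} u → n ≤ u → Cut n u
  cut {n} = <-rec (λ u → n ≤ u → Cut n u) step
    where
    step : ∀ u → (∀ {i} → i < u → n ≤ i → Cut n i) → n ≤ u → Cut n u
    step u rec n≤u with anyUpTo? (λ i → (n ≤? i) ×-dec (i ≺? u)) u
    ... | yes (i , i<u , n≤i , i≺u) = record
      { node          = node
      ; n≤node        = n≤node
      ; node≼u        = [ ≼-≺-trans node≼u i≺u ]
      ; pred<n        = pred<n
      ; pred-restrict = λ l<n l≺u → pred-restrict l<n (≺-chain (<-≤-trans l<n n≤i) l≺u i≺u)
      }
      where
      open Cut (rec i<u n≤i)
    ... | no none = record
      { node          = u
      ; n≤node        = n≤u
      ; node≼u        = refl
      ; pred<n        = λ l≺u → ≰⇒> λ n≤l → none (_ , ≺⇒< l≺u , n≤l , l≺u)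
      ; pred-restrict = λ _ l≺u → l≺u
      }

module Coding (c : Colouring) (β : ℕ → ℕ) (α : ℕ → Bool)
  (code : ∀ N → ∃ λ k → N ≤ k × k ≤ β N × (∀ i → i < N → (α i ≡ false) ⇔ (i ≺[ c ] k))) where
  open ErdősRado c
  open _≺_

  record Node (n : ℕ) : Set where
    field
      bound key : ℕ
      n≤bound   : n ≤ bound
      bound≤key : bound ≤ key
      key≤β     : key ≤ β bound
      codes     : ∀ {i} → i < bound → (α i ≡ false ⇔ i ≺ key)

    open Cut (cut key (≤-trans n≤bound bound≤key)) public

    pred⇔zero : ∀ {l} → l ≺ node ⇔ (l < n × α l ≡ false)
    pred⇔zero = mk⇔ (λ l≺node → let l<n = pred<n l≺node in
                                  l<n , from (codes (<-≤-trans l<n n≤bound)) (pred⊆ l≺node))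
                    (λ (l<n , αl) → pred-restrict l<n (to (codes (<-≤-trans l<n n≤bound)) αl))
  open Node

  nodeAt : ∀ {n} N → n ≤ N → Node n
  nodeAt N n≤N = record
    { bound     = N
    ; key       = proj₁ (code N)
    ; n≤bound   = n≤N
    ; bound≤key = proj₁ (proj₂ (code N))
    ; key≤β     = proj₁ (proj₂ (proj₂ (code N)))
    ; codes     = λ i<N → let h = proj₂ (proj₂ (proj₂ (code N))) _ i<N in mk⇔ (mk≺ ∘ to h) (from h ∘ holds)
    }

  bound≤node : ∀ {n} (x : Node n) → (∀ {i} → n ≤ i → i < bound x → α i ≡ true) → bound x ≤ node x
  bound≤node x no-zero = ≮⇒≥ λ node<bound →
    let node≺key = ≼∧<⇒≺ (node≼u x) (<-≤-trans node<bound (bound≤key x)) in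
    contradiction (trans (sym (no-zero (n≤node x) node<bound)) (from (codes x node<bound) node≺key)) λ ()

  module _ {n p} (p<n : p < n) (αp : α p ≡ false) (p-top : ∀ {i} → i < n → α i ≡ false → i ≤ p) where

    collide : (x y : Node n) → node x < node y → c p (node x) ≡ c p (node y) → node x ≺ key y
    collide x y x<y cpx≡cpy = pred⊆ y (≺-by-top-colour x<y
      (λ l≺x → from (pred⇔zero y) (to (pred⇔zero x) l≺x))
      (from (pred⇔zero x) (p<n , αp))
      (λ l≺x → let (l<n , αl) = to (pred⇔zero x) l≺x in p-top l<n αl)
      cpx≡cpy)

  α0≡false : α 0 ≡ false
  α0≡false = let (k , 1≤k , _ , h) = code 1 in from (h 0 z<s) (holds (0≺ 1≤k))

  no-zero-free-window : ∀ {n} → 0 < n → ¬ (∀ {i} → n ≤ i → i ≤ β (β n + 1) → α i ≡ true)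
  no-zero-free-window {n} 0<n no-zero with maximiseBelow (λ i → α i ≟ᵇ false) n 0<n α0≡false
  ... | (p , p<n , αp , p-top) = triangle
    where
    m = β n + 1
    B = β m

    clash : (x y : Node n) → node x ≤ B → node x < node y → node x < bound y →
            c p (node x) ≡ c p (node y) → ⊥
    clash x y x≤B x<y x<bound cpx≡cpy =
      contradiction (trans (sym (no-zero (n≤node x) x≤B)) (from (codes y x<bound) (collide p<n αp p-top x y x<y cpx≡cpy))) λ ()

    xa : Node n
    xa = nodeAt n ≤-refl
    a′<m : node xa < m
    a′<m = ≤-<-trans (≤-trans (node≤u xa) (key≤β xa)) (m<m+n (β n) z<s)

    xb : Node n
    xb = nodeAt m (≤-trans (≤-trans (bound≤key xa) (key≤β xa)) (m≤m+n (β n) 1))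
    b = key xb
    b≤B : b ≤ B
    b≤B = key≤β xb
    m≤b′ : m ≤ node xb
    m≤b′ = bound≤node xb λ n≤i i<m → no-zero n≤i (≤-trans (<⇒≤ i<m) (≤-trans (bound≤key xb) b≤B))
    a′<b : node xa < b
    a′<b = <-≤-trans a′<m (≤-trans m≤b′ (node≤u xb))

    xd : Node n
    xd = nodeAt (suc b) (≤-trans (n≤node xb) (≤-trans (node≤u xb) (n≤1+n b)))
    b<d′ : b < node xd
    b<d′ = bound≤node xd λ n≤i i<1+b → no-zero n≤i (≤-trans (≤-pred i<1+b) b≤B)

    triangle : ⊥
    triangle with pigeonhole (c p (node xa)) (c p (node xb)) (c p (node xd))
    ... | inj₁ ab        = clash xa xb (≤-trans (<⇒≤ a′<b) b≤B) (<-≤-trans a′<m m≤b′) a′<m ab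
    ... | inj₂ (inj₁ ad) = clash xa xd (≤-trans (<⇒≤ a′<b) b≤B) (<-trans a′<b b<d′) (m<n⇒m<1+n a′<b) ad
    ... | inj₂ (inj₂ bd) = clash xb xd (≤-trans (node≤u xb) b≤B) (≤-<-trans (node≤u xb) b<d′) (s≤s (node≤u xb)) bd

  zeroFrom? : ∀ n → Decidable (λ i → n ≤ i × α i ≡ false)
  zeroFrom? n i = (n ≤? i) ×-dec (α i ≟ᵇ false)

  leastZeroIn : ∀ n → 0 < n → Σ ℕ (IsLeastZeroIn α n (β (β n + 1)))
  leastZeroIn n 0<n with anyUpTo? (zeroFrom? n) (suc (β (β n + 1)))
  ... | no none = contradiction (λ {i} n≤i i≤B → ¬-not λ αi → none (_ , s≤s i≤B , n≤i , αi)) (no-zero-free-window 0<n)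
  ... | yes (k , k<1+B , zero-k) with minimise (zeroFrom? n) zero-k
  ...   | (j , j≤k , (n≤j , αj) , below) =
          j , n≤j , ≤-trans j≤k (≤-pred k<1+B) , αj , λ i n≤i i<j → ¬-not λ αi → below i<j (n≤i , αi)

lemma2p7 : (c : Colouring) → Symmetric c →
    (β : ℕ → ℕ) →
    (∀ n (s : Fin n → Bool) → (∃ λ k → T′ c s k) → T′ c s (β n)) →
    (α : ℕ → Bool) →
    (∀ n → ∃ λ k → n ≤ k × k ≤ β n × (∀ i → i < n → (α i ≡ false) ⇔ (i ≺[ c ] k))) →
    Σ (ℕ → ℕ) λ a →
    a 0 ≡ 0 ×
    (∀ n → 0 < n → IsLeastZeroIn α n (β (β n + 1)) (a n)) ×
    (∀ n → α (a n) ≡ false) ×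
    (∀ n → ∃ λ k → n ≤ k × α k ≡ false)
lemma2p7 c _ β _ α code = a , refl , a-least , α∘a≡false , unbounded
  where
  open Coding c β α code

  a : ℕ → ℕ
  a zero      = 0
  a n@(suc _) = proj₁ (leastZeroIn n z<s)

  a-least : ∀ n → 0 < n → IsLeastZeroIn α n (β (β n + 1)) (a n)
  a-least n@(suc _) _ = proj₂ (leastZeroIn n z<s)

  α∘a≡false : ∀ n → α (a n) ≡ false
  α∘a≡false zero      = α0≡false
  α∘a≡false n@(suc _) = let (_ , _ , αa , _) = a-least n z<s in αa

  unbounded : ∀ n → ∃ λ k → n ≤ k × α k ≡ false
  unbounded n = a (suc n) , ≤-trans (n≤1+n n) (proj₁ (a-least (suc n) z<s)) , α∘a≡false (suc n)
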